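{- Let $G$ be a finite connected graph with at least two cycles, let $G_{\mathrm{int}}$ be its 2-core, and let $E^G_{\mathrm{ext}}$ be the set of edges of $G$ not in $G_{\mathrm{int}}$, each directed away from the 2-core. Then there exists a function $\Delta: E^G_{\mathrm{ext}} \to (0,1]$ such that for every directed edge $(u,v)\in E^G_{\mathrm{ext}}$, $$\sum_{w:\ (v,w) \in E^G_{\mathrm{ext}}} \Delta(v,w) < \Delta(u,v).$$
   Context: Graphs may have multiple edges and loops; loops or pairs of parallel edges count as cycles. The 2-core of $G$ is the subgraph obtained by repeatedly deleting a leaf (a degree-1 vertex with its edge) until no leaves remain. For each edge $\{u,v\}$ of $G$ not in the 2-core there is a unique shortest path from the 2-core that ends by traversing this edge; the edge is oriented in the direction in which this path traverses it ("directed away from the 2-core"). -}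

module Defs where

open import Data.Nat using (ℕ; zero; suc)
open import Data.Fin using (Fin)
open import Data.Product using (_×_; _,_; Σ; ∃; ∃-syntax)
open import Data.Sum using (_⊎_)
open import Data.List using (List; []; _∷_; foldr)
open import Data.List.Membership.Propositional using (_∈_; _∉_)
open import Data.List.Relation.Unary.Unique.Propositional using (Unique)
open import Data.Rational using (ℚ; 0ℚ; _+_)
open import Relation.Binary.PropositionalEquality using (_≡_; _≢_)
open import Relation.Nullary using (¬_)

-- A finite (multi)graph, loops and parallel edges allowed:
-- vertices Fin n, edges Fin m, each edge has an unordered pair of endpoints
-- (given as an ordered pair, whose order carries no meaning).
record Graph : Set where
  field
    n    : ℕ
    m    : ℕ
    ends : Fin m → Fin n × Fin n

module _ (G : Graph) where
  open Graph G

  V : Set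
  V = Fin n

  E : Set
  E = Fin m

  Step : E → V → V → Set
  Step e a b = (ends e ≡ (a , b)) ⊎ (ends e ≡ (b , a))

  Incident : E → V → Set
  Incident e v = ∃[ w ] Step e v w

  data Walk : V → V → Set where
    nil  : ∀ {x} → Walk x x
    cons : ∀ {x y z} (e : E) → Step e x y → Walk y z → Walk x z

  length : ∀ {x y} → Walk x y → ℕ
  length nil          = zero
  length (cons _ _ w) = suc (length w)

  edges : ∀ {x y} → Walk x y → List E
  edges nil          = []
  edges (cons e _ w) = e ∷ edges w

  -- vertices reached after each step (the start vertex is not listed,
  -- so for a closed walk it appears exactly once, at the end)
  verts : ∀ {x y} → Walk x y → List V
  verts nil                    = []
  verts (cons {y = y} _ _ w)   = y ∷ verts w

  Connected : Set
  Connected = (x y : V) → Walk x y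

  -- A cycle: a closed walk of positive length with no repeated edge and
  -- no repeated vertex (a loop is a cycle of length 1, two parallel edges
  -- form a cycle of length 2).
  record Cycle : Set where
    field
      base     : V
      walk     : Walk base base
      nonempty : length walk ≢ zero
      edgesUnique : Unique (edges walk)
      vertsUnique : Unique (verts walk)

  -- G has at least two (distinct) cycles: two cycles with different edge sets.
  AtLeastTwoCycles : Set
  AtLeastTwoCycles =
    Σ Cycle λ c₁ → Σ Cycle λ c₂ →
      ∃[ e ] (e ∈ edges (Cycle.walk c₁) × e ∉ edges (Cycle.walk c₂))

  -- Edges removed by repeated deletion of leaves (degree-1 vertices with
  -- their edge).  An edge e = {u,v} (not a loop) gets deleted as the edge of
  -- the leaf v once every other edge incident to v has been deleted.
  -- (Least fixed point of this deletion step = result of the iteration.)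
  data Peeled : E → Set where
    peel : ∀ {e u v} → Step e u v → u ≢ v →
           (∀ f → Incident f v → f ≢ e → Peeled f) → Peeled e

  InCore : E → Set
  InCore e = ¬ Peeled e

  CoreVertex : V → Set
  CoreVertex v = ∃[ e ] (InCore e × Incident e v)

  PathFromCoreVia : E → V → V → Set
  PathFromCoreVia e u v = Σ V λ x → CoreVertex x × Walk x u × Step e u v

  lenPFC : ∀ {e u v} → PathFromCoreVia e u v → ℕ
  lenPFC (_ , _ , w , _) = suc (length w)

  -- Orientation of an external edge e: (u,v) is the direction in which a
  -- shortest walk from the 2-core ending by traversing e traverses it.
  Oriented : E → V → V → Set
  Oriented e u v =
    ¬ InCore e ×
    Σ (PathFromCoreVia e u v) λ p →
      ∀ u' v' (q : PathFromCoreVia e u' v') → lenPFC p Data.Nat.≤ lenPFC q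

sumℚ : List ℚ → ℚ
sumℚ = foldr _+_ 0ℚ

module Submission where

-- Leaf deletion is run in rounds: round k + 1 removes every edge
-- that is the pendant edge of a leaf once the edges removed in the first k
-- rounds are gone.  A saturation argument for monotone operators on subsets of
-- the m edges shows that after m rounds exactly the Peeled (non-core) edges
-- are gone; the rank of an edge is the number of these rounds it survives.
--
-- The key fact (tail-not-leaf) is that an oriented edge (u,v) is removed as the
-- pendant edge of its head v, never of its tail u: otherwise a shortest walk
-- from the core ending with it could be shortened (shortcut).  So every other
-- edge at v, in particular every edge oriented out of v, is removed strictly
-- earlier and has smaller rank (rank-drops).  With weights (m+1)^rank the at
-- most m edges leaving v weigh less in total than (u,v), and rescaling puts
-- the weights into (0,1].

open import Defs
open import Data.Fin using (Fin; zero; suc; _≟_)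
open import Data.Product using (_×_; _,_; Σ; ∃-syntax; proj₁; proj₂)
open import Data.List using (List; []; _∷_; map; lookup)
open import Data.List.Membership.Propositional using (_∈_)
open import Data.List.Relation.Unary.Unique.Propositional using (Unique)
open import Data.Rational using (ℚ; 0ℚ; 1ℚ; _<_; _≤_; _+_; _*_; 1/_; Positive; NonNegative; NonZero; positive)
open import Relation.Nullary using (¬_; Dec; yes; no; does)

open import Data.Nat as ℕ using (ℕ; zero; suc; z≤n; s≤s; _^_)
import Data.Nat.Properties as ℕP
open import Data.Nat.Induction using (<-rec)
open import Data.Nat.ListAction using (sum)
open import Data.Fin.Properties using (injective⇒≤; all?)
open import Data.Fin.Subset using (Subset; _⊆_; _⊂_; ∣_∣)
  renaming (_∈_ to _∈ₛ_; _∉_ to _∉ₛ_; ⊥ to ∅)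
open import Data.Fin.Subset.Properties using (_⊂?_; _∈?_; p⊂q⇒∣p∣<∣q∣; ∣p∣≤n; ∣p∣≡n⇒p≡⊤; ⊆⊤; ∉⊥)
open import Data.Vec using (tabulate)
open import Data.Vec.Properties using (lookup∘tabulate; []=⇒lookup; lookup⇒[]=)
open import Data.Sum using (_⊎_; inj₁; inj₂)
open import Data.Empty using (⊥-elim)
import Data.List as List
open import Data.List.Membership.Propositional.Properties using (∈-lookup)
open import Data.List.Relation.Unary.Any using (here; there)
import Data.List.Relation.Unary.All as All
open import Data.List.Relation.Unary.AllPairs using (_∷_)
open import Data.Rational.Properties
  using ( +-identityˡ; +-assoc; +-monoˡ-<; positive⁻¹; <-trans; <⇒≤; ≤-refl
        ; pos⇒nonZero; 1/pos⇒pos; pos⇒nonNeg; *-zeroˡ; *-distribʳ-+; *-monoˡ-<-pos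
        ; *-inverseʳ; *-monoʳ-≤-nonNeg; _<?_ )
open import Relation.Nullary.Decidable using (dec-true; decidable-stable; _×-dec_; _⊎-dec_; _→-dec_; ¬?)
open import Relation.Unary using (Decidable)
open import Relation.Binary.PropositionalEquality
  using (_≡_; _≢_; refl; sym; trans; cong; subst; module ≡-Reasoning)

-- The embedding of ℕ into ℚ, as iterated successor; it is additive and
-- strictly monotone, which is all that is needed to transport ℕ-inequalities.
fromℕ : ℕ → ℚ
fromℕ zero    = 0ℚ
fromℕ (suc k) = 1ℚ + fromℕ k

fromℕ-+ : ∀ a b → fromℕ (a ℕ.+ b) ≡ fromℕ a + fromℕ b
fromℕ-+ zero    b = sym (+-identityˡ (fromℕ b))
fromℕ-+ (suc a) b = trans (cong (1ℚ +_) (fromℕ-+ a b)) (sym (+-assoc 1ℚ (fromℕ a) (fromℕ b)))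

fromℕ-<-suc : ∀ a → fromℕ a < fromℕ (suc a)
fromℕ-<-suc a = subst (_< 1ℚ + fromℕ a) (+-identityˡ (fromℕ a)) (+-monoˡ-< (fromℕ a) (positive⁻¹ 1ℚ))

fromℕ-mono-< : ∀ {a b} → a ℕ.< b → fromℕ a < fromℕ b
fromℕ-mono-< {a} {suc b} (s≤s a≤b) with ℕP.m≤n⇒m<n∨m≡n a≤b
... | inj₁ a<b  = <-trans (fromℕ-mono-< a<b) (fromℕ-<-suc b)
... | inj₂ refl = fromℕ-<-suc a

fromℕ-mono-≤ : ∀ {a b} → a ℕ.≤ b → fromℕ a ≤ fromℕ b
fromℕ-mono-≤ a≤b with ℕP.m≤n⇒m<n∨m≡n a≤b
... | inj₁ a<b  = <⇒≤ (fromℕ-mono-< a<b)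
... | inj₂ refl = ≤-refl

module Rescale {X : Set} (D : ℕ) (w : X → ℕ) where

  private instance
    denominator-positive : Positive (fromℕ (suc D))
    denominator-positive = positive (fromℕ-mono-< {0} {suc D} (s≤s z≤n))
    denominator-nonZero : NonZero (fromℕ (suc D))
    denominator-nonZero = pos⇒nonZero (fromℕ (suc D))
    scale-positive : Positive (1/ fromℕ (suc D))
    scale-positive = 1/pos⇒pos (fromℕ (suc D))
    scale-nonNegative : NonNegative (1/ fromℕ (suc D))
    scale-nonNegative = pos⇒nonNeg (1/ fromℕ (suc D))

  scale : ℚ
  scale = 1/ fromℕ (suc D)

  Δ : X → ℚ
  Δ x = fromℕ (w x) * scale

  sumℚ-Δ : ∀ L → sumℚ (map Δ L) ≡ fromℕ (sum (map w L)) * scale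
  sumℚ-Δ []      = sym (*-zeroˡ scale)
  sumℚ-Δ (x ∷ L) = begin
    fromℕ (w x) * scale + sumℚ (map Δ L)                  ≡⟨ cong (fromℕ (w x) * scale +_) (sumℚ-Δ L) ⟩
    fromℕ (w x) * scale + fromℕ (sum (map w L)) * scale   ≡⟨ *-distribʳ-+ scale (fromℕ (w x)) _ ⟨
    (fromℕ (w x) + fromℕ (sum (map w L))) * scale         ≡⟨ cong (_* scale) (fromℕ-+ (w x) _) ⟨
    fromℕ (w x ℕ.+ sum (map w L)) * scale                 ∎
    where open ≡-Reasoning

  Δ-positive : ∀ x → 1 ℕ.≤ w x → 0ℚ < Δ x
  Δ-positive x 1≤w = subst (_< Δ x) (*-zeroˡ scale) (*-monoˡ-<-pos scale (fromℕ-mono-< 1≤w))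

  Δ-≤1 : ∀ x → w x ℕ.≤ suc D → Δ x ≤ 1ℚ
  Δ-≤1 x w≤ = subst (Δ x ≤_) (*-inverseʳ (fromℕ (suc D))) (*-monoʳ-≤-nonNeg scale (fromℕ-mono-≤ w≤))

  sum-Δ-< : ∀ x L → sum (map w L) ℕ.< w x → sumℚ (map Δ L) < Δ x
  sum-Δ-< x L lt = subst (_< Δ x) (sym (sumℚ-Δ L)) (*-monoˡ-<-pos scale (fromℕ-mono-< lt))

unique-lookup-injective : ∀ {A : Set} {xs : List A} → Unique xs →
                          ∀ {i j} → lookup xs i ≡ lookup xs j → i ≡ j
unique-lookup-injective (_    ∷ _) {zero}  {zero}  _  = refl
unique-lookup-injective (x∉xs ∷ _) {zero}  {suc j} eq = ⊥-elim (All.lookup x∉xs (∈-lookup j) eq)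
unique-lookup-injective (x∉xs ∷ _) {suc i} {zero}  eq = ⊥-elim (All.lookup x∉xs (∈-lookup i) (sym eq))
unique-lookup-injective (_ ∷ uniq) {suc i} {suc j} eq = cong suc (unique-lookup-injective uniq eq)

unique-length≤ : ∀ {k} (L : List (Fin k)) → Unique L → List.length L ℕ.≤ k
unique-length≤ L uniq = injective⇒≤ (unique-lookup-injective uniq)

sum-of-powers-< : ∀ {X : Set} (w : X → ℕ) b j (L : List X) → List.length L ℕ.≤ b →
                  (∀ x → x ∈ L → w x ℕ.≤ suc b ^ j) → sum (map w L) ℕ.< suc b ^ suc j
sum-of-powers-< w b j L len≤b w≤ = begin-strict
  sum (map w L)                ≤⟨ sum≤ L w≤ ⟩
  List.length L ℕ.* suc b ^ j  ≤⟨ ℕP.*-monoˡ-≤ (suc b ^ j) len≤b ⟩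
  b ℕ.* suc b ^ j              <⟨ ℕP.m<n+m (b ℕ.* suc b ^ j) (ℕP.m^n>0 (suc b) j) ⟩
  suc b ^ suc j                ∎
  where
  open ℕP.≤-Reasoning
  sum≤ : ∀ L → (∀ x → x ∈ L → w x ℕ.≤ suc b ^ j) → sum (map w L) ℕ.≤ List.length L ℕ.* suc b ^ j
  sum≤ []      _  = z≤n
  sum≤ (x ∷ L) w≤ = ℕP.+-mono-≤ (w≤ x (here refl)) (sum≤ L (λ y y∈ → w≤ y (there y∈)))

select : ∀ {n} {P : Fin n → Set} → Decidable P → Subset n
select P? = tabulate (λ x → does (P? x))

select⁺ : ∀ {n} {P : Fin n → Set} (P? : Decidable P) {x} → P x → x ∈ₛ select P?
select⁺ P? {x} px = lookup⇒[]= x _ (trans (lookup∘tabulate _ x) (dec-true (P? x) px))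

select⁻ : ∀ {n} {P : Fin n → Set} (P? : Decidable P) {x} → x ∈ₛ select P? → P x
select⁻ P? {x} x∈ with P? x | trans (sym (lookup∘tabulate _ x)) ([]=⇒lookup x∈)
... | yes px | _  = px
... | no  _  | ()

-- Kleene iteration of an inflationary monotone operator on subsets of Fin n
-- starting from ∅: each round either adds an element or has reached a fixed
-- point, so after n rounds a fixed point has been reached.
module Saturation {n} (F : Subset n → Subset n)
                  (inflationary : ∀ p → p ⊆ F p)
                  (monotone : ∀ {p q} → p ⊆ q → F p ⊆ F q) where

  iterate : ℕ → Subset n
  iterate zero    = ∅
  iterate (suc k) = F (iterate k)

  iterate-mono : ∀ {j k} → j ℕ.≤ k → iterate j ⊆ iterate k
  iterate-mono z≤n       x∈ = ⊥-elim (∉⊥ x∈)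
  iterate-mono (s≤s j≤k) x∈ = monotone (iterate-mono j≤k) x∈

  Stable : ℕ → Set
  Stable k = F (iterate k) ⊆ iterate k

  stable-suc : ∀ k → Stable k → Stable (suc k)
  stable-suc k st = monotone st

  not-strict⇒⊇ : ∀ {p q : Subset n} → p ⊆ q → ¬ (p ⊂ q) → q ⊆ p
  not-strict⇒⊇ {p} p⊆q p⊄q {x} x∈q with x ∈? p
  ... | yes x∈p = x∈p
  ... | no  x∉p = ⊥-elim (p⊄q (p⊆q , x , x∈q , x∉p))

  growth : ∀ k → k ℕ.≤ ∣ iterate k ∣ ⊎ Stable k
  growth zero = inj₁ z≤n
  growth (suc k) with growth k
  ... | inj₂ st = inj₂ (stable-suc k st)
  ... | inj₁ k≤ with iterate k ⊂? iterate (suc k)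
  ...   | yes grows = inj₁ (ℕP.≤-trans (s≤s k≤) (p⊂q⇒∣p∣<∣q∣ grows))
  ...   | no  stuck = inj₂ (stable-suc k (not-strict⇒⊇ (inflationary _) stuck))

  closure : Subset n
  closure = iterate n

  closure-fixed : F closure ⊆ closure
  closure-fixed with growth n
  ... | inj₂ st = st
  ... | inj₁ n≤ = subst (F closure ⊆_) (sym (∣p∣≡n⇒p≡⊤ (ℕP.≤-antisym (∣p∣≤n closure) n≤))) ⊆⊤

-- For an upward closed decidable property P of ℕ, the number of k < K at
-- which P fails is the time at which P starts to hold, capped at K.
module EntryTime {P : ℕ → Set} (P? : Decidable P)
                 (upward : ∀ {j k} → j ℕ.≤ k → P j → P k) where

  failure : ℕ → ℕ
  failure k with P? k
  ... | yes _ = 0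
  ... | no  _ = 1

  entry : ℕ → ℕ
  entry zero    = 0
  entry (suc K) = entry K ℕ.+ failure K

  entry≤ : ∀ K → entry K ℕ.≤ K
  entry≤ zero = z≤n
  entry≤ (suc K) with P? K
  ... | yes _ = ℕP.m≤n⇒m≤1+n (ℕP.≤-trans (ℕP.≤-reflexive (ℕP.+-identityʳ _)) (entry≤ K))
  ... | no  _ = ℕP.≤-trans (ℕP.≤-reflexive (ℕP.+-comm (entry K) 1)) (s≤s (entry≤ K))

  entry-mono : ∀ {J K} → J ℕ.≤ K → entry J ℕ.≤ entry K
  entry-mono {K = zero}  z≤n = z≤n
  entry-mono {J} {suc K} J≤ with ℕP.m≤n⇒m<n∨m≡n J≤
  ... | inj₁ (s≤s J≤K) = ℕP.≤-trans (entry-mono J≤K) (ℕP.m≤m+n (entry K) _)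
  ... | inj₂ refl      = ℕP.≤-refl

  entry≤-holds : ∀ {j} → P j → ∀ K → entry K ℕ.≤ j
  entry≤-holds pj zero = z≤n
  entry≤-holds {j} pj (suc K) with j ℕ.≤? K
  ... | no  K<j = ℕP.≤-trans (entry≤ (suc K)) (ℕP.≰⇒> K<j)
  ... | yes j≤K with P? K
  ...   | yes _  = ℕP.≤-trans (ℕP.≤-reflexive (ℕP.+-identityʳ _)) (entry≤-holds pj K)
  ...   | no ¬pK = ⊥-elim (¬pK (upward j≤K pj))

  entry-full : ∀ {j} → ¬ P j → ∀ K → K ℕ.≤ suc j → entry K ≡ K
  entry-full ¬pj zero _ = refl
  entry-full ¬pj (suc K) (s≤s K≤j) with P? K
  ... | yes pK = ⊥-elim (¬pj (upward K≤j pK))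
  ... | no  _  = trans (ℕP.+-comm (entry K) 1) (cong suc (entry-full ¬pj K (ℕP.m≤n⇒m≤1+n K≤j)))

  entry>-fails : ∀ {j K} → ¬ P j → j ℕ.< K → j ℕ.< entry K
  entry>-fails {j} ¬pj j<K =
    ℕP.≤-trans (ℕP.≤-reflexive (sym (entry-full ¬pj (suc j) ℕP.≤-refl))) (entry-mono j<K)

  first-entry : ∀ {K} → ¬ P 0 → P K → ∃[ j ] (j ℕ.< K × ¬ P j × P (suc j))
  first-entry {suc K} ¬p0 pK with P? K
  ... | no ¬pK = K , ℕP.≤-refl , ¬pK , pK
  ... | yes pK′ with first-entry ¬p0 pK′
  ...   | j , j<K , rest = j , ℕP.m<n⇒m<1+n j<K , rest
  first-entry {zero} ¬p0 p0 = ⊥-elim (¬p0 p0)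

module Traversal (G : Graph) where
  open Graph G

  step-flip : ∀ {g a b} → Step G g a b → Step G g b a
  step-flip (inj₁ p) = inj₂ p
  step-flip (inj₂ p) = inj₁ p

  step-other-end : ∀ {g a y c} → Step G g a c → Step G g y c → a ≢ c → a ≡ y
  step-other-end (inj₁ p) (inj₁ q) _   = cong proj₁ (trans (sym p) q)
  step-other-end (inj₁ p) (inj₂ q) a≢c = ⊥-elim (a≢c (cong proj₁ (trans (sym p) q)))
  step-other-end (inj₂ p) (inj₁ q) a≢c = ⊥-elim (a≢c (cong proj₂ (trans (sym p) q)))
  step-other-end (inj₂ p) (inj₂ q) _   = cong proj₂ (trans (sym p) q)

  step-target : ∀ {g a′ c′ y c} → Step G g a′ c′ → Step G g y c → c′ ≡ c ⊎ c′ ≡ y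
  step-target (inj₁ p) (inj₁ q) = inj₁ (cong proj₂ (trans (sym p) q))
  step-target (inj₁ p) (inj₂ q) = inj₂ (cong proj₂ (trans (sym p) q))
  step-target (inj₂ p) (inj₁ q) = inj₂ (cong proj₁ (trans (sym p) q))
  step-target (inj₂ p) (inj₂ q) = inj₁ (cong proj₁ (trans (sym p) q))

  incident? : ∀ f v → Dec (Incident G f v)
  incident? f v with proj₁ (ends f) ≟ v | proj₂ (ends f) ≟ v
  ... | yes p | _     = yes (proj₂ (ends f) , inj₁ (cong (_, proj₂ (ends f)) p))
  ... | no _  | yes q = yes (proj₁ (ends f) , inj₂ (cong (proj₁ (ends f) ,_) q))
  ... | no ¬p | no ¬q = no λ { (_ , inj₁ eq) → ¬p (cong proj₁ eq) ; (_ , inj₂ eq) → ¬q (cong proj₂ eq) }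

  record LastStep {x z} (W : Walk G x z) : Set where
    field
      {penultimate} : V G
      init          : Walk G x penultimate
      edge          : E G
      step          : Step G edge penultimate z
      init-shorter  : length G init ℕ.< length G W

  lastStep : ∀ {x y z} e (st : Step G e x y) (W : Walk G y z) → LastStep (cons e st W)
  lastStep e st nil = record { init = nil ; edge = e ; step = st ; init-shorter = ℕP.≤-refl }
  lastStep e st (cons e′ st′ W) =
    let open LastStep (lastStep e′ st′ W) in
    record { init = cons e st init ; edge = edge ; step = step ; init-shorter = ℕ.s≤s init-shorter }

module Peeling (G : Graph) where
  open Graph G
  open Traversal G

  OthersRemoved : Subset m → E G → V G → Set
  OthersRemoved S e v = ∀ f → Incident G f v → f ≢ e → f ∈ₛ S

  Pendant : Subset m → E G → V G → V G → Set
  Pendant S e u v = Step G e u v × u ≢ v × OthersRemoved S e v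

  -- a decidable form of "e is pendant in one of its two directions"
  Peelable : Subset m → E G → Set
  Peelable S e = proj₁ (ends e) ≢ proj₂ (ends e) ×
                 (OthersRemoved S e (proj₂ (ends e)) ⊎ OthersRemoved S e (proj₁ (ends e)))

  peelable? : ∀ S e → Dec (Peelable S e)
  peelable? S e = ¬? (proj₁ (ends e) ≟ proj₂ (ends e)) ×-dec (others? _ ⊎-dec others? _)
    where
    others? : ∀ v → Dec (OthersRemoved S e v)
    others? v = all? (λ f → incident? f v →-dec (¬? (f ≟ e) →-dec (f ∈? S)))

  peelable⇒pendant : ∀ {S e} → Peelable S e → ∃[ u ] ∃[ v ] Pendant S e u v
  peelable⇒pendant (a≢b , inj₁ others) = _ , _ , inj₁ refl , a≢b , others
  peelable⇒pendant (a≢b , inj₂ others) = _ , _ , inj₂ refl , (λ b≡a → a≢b (sym b≡a)) , others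

  pendant⇒peelable : ∀ {S e u v} → Pendant S e u v → Peelable S e
  pendant⇒peelable (inj₁ refl , u≢v , others) = u≢v , inj₁ others
  pendant⇒peelable (inj₂ refl , u≢v , others) = (λ v≡u → u≢v (sym v≡u)) , inj₂ others

  gone? : ∀ S e → Dec (e ∈ₛ S ⊎ Peelable S e)
  gone? S e = e ∈? S ⊎-dec peelable? S e

  -- one round of leaf deletion; kept opaque so that it is only ever used
  -- through its membership characterisation
  opaque
    peelRound : Subset m → Subset m
    peelRound S = select (gone? S)

    peelRound⁺ : ∀ {S e} → e ∈ₛ S ⊎ Peelable S e → e ∈ₛ peelRound S
    peelRound⁺ {S} = select⁺ (gone? S)

    peelRound⁻ : ∀ {S e} → e ∈ₛ peelRound S → e ∈ₛ S ⊎ Peelable S e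
    peelRound⁻ {S} = select⁻ (gone? S)

  peelRound-inflationary : ∀ S → S ⊆ peelRound S
  peelRound-inflationary S e∈S = peelRound⁺ (inj₁ e∈S)

  peelRound-monotone : ∀ {S S′} → S ⊆ S′ → peelRound S ⊆ peelRound S′
  peelRound-monotone S⊆S′ e∈ with peelRound⁻ e∈
  ... | inj₁ e∈S                 = peelRound⁺ (inj₁ (S⊆S′ e∈S))
  ... | inj₂ (a≢b , inj₁ others) = peelRound⁺ (inj₂ (a≢b , inj₁ (λ f i f≢e → S⊆S′ (others f i f≢e))))
  ... | inj₂ (a≢b , inj₂ others) = peelRound⁺ (inj₂ (a≢b , inj₂ (λ f i f≢e → S⊆S′ (others f i f≢e))))

  open Saturation peelRound peelRound-inflationary peelRound-monotone public
    renaming (iterate to removed; iterate-mono to removed-mono)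

  removed⇒peeled : ∀ k {e} → e ∈ₛ removed k → Peeled G e
  removed⇒peeled zero    e∈ = ⊥-elim (∉⊥ e∈)
  removed⇒peeled (suc k) e∈ with peelRound⁻ e∈
  ... | inj₁ e∈prev = removed⇒peeled k e∈prev
  ... | inj₂ peelable with peelable⇒pendant peelable
  ...   | _ , _ , st , u≢v , others = peel st u≢v (λ f i f≢e → removed⇒peeled k (others f i f≢e))

  peeled⇒removed : ∀ {e} → Peeled G e → e ∈ₛ closure
  peeled⇒removed (peel st u≢v h) =
    closure-fixed (peelRound⁺ (inj₂ (pendant⇒peelable (st , u≢v , λ f i f≢e → peeled⇒removed (h f i f≢e)))))

  record FreshLeaf (i : ℕ) (h : E G) (a c : V G) : Set where
    constructor leaf
    field
      still-present : h ∉ₛ removed i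
      pendant       : Pendant (removed i) h a c

  fresh-leaf : ∀ j {e} → e ∉ₛ removed j → e ∈ₛ removed (suc j) → ∃[ a ] ∃[ c ] FreshLeaf j e a c
  fresh-leaf j e∉ e∈ with peelRound⁻ e∈
  ... | inj₁ e∈prev   = ⊥-elim (e∉ e∈prev)
  ... | inj₂ peelable with peelable⇒pendant peelable
  ...   | a , c , pendant = a , c , leaf e∉ pendant

  removal-round : ∀ K {e} → e ∈ₛ removed K → ∃[ j ] (j ℕ.< K × ∃[ a ] ∃[ c ] FreshLeaf j e a c)
  removal-round K {e} e∈
    with EntryTime.first-entry (λ k → e ∈? removed k) (λ j≤k → removed-mono j≤k) {K} ∉⊥ e∈
  ... | j , j<K , e∉ , e∈next = j , j<K , fresh-leaf j e∉ e∈next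

  -- the only edge at a fresh leaf c is h, so (c being a leaf) no core edge meets c
  core-not-leaf : ∀ {i h a c} → FreshLeaf i h a c → ¬ CoreVertex G c
  core-not-leaf {i} {h} (leaf _ pendant@(_ , _ , others)) (g , g-core , g-at-c) with g ≟ h
  ... | yes refl = g-core (removed⇒peeled (suc i) (peelRound⁺ (inj₂ (pendant⇒peelable pendant))))
  ... | no  g≢h  = g-core (removed⇒peeled i (others g g-at-c g≢h))

  earlier-leaf : ∀ {i h a c g y} → FreshLeaf i h a c → Step G g y c → g ≢ h → ∃[ j ] FreshLeaf j g c y
  earlier-leaf {i} {h} {a} (leaf h∉ (h-step , _ , others)) g-step g≢h
    with removal-round i (others _ (_ , step-flip g-step) g≢h)
  ... | j , j<i , a′ , c′ , fresh@(leaf _ (g-step′ , a′≢c′ , others′)) with step-target g-step′ g-step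
  ...   | inj₁ refl = ⊥-elim (h∉ (removed-mono (ℕP.<⇒≤ j<i) h∈removed-j))
    where h∈removed-j = others′ h (a , step-flip h-step) λ h≡g → g≢h (sym h≡g)
  ...   | inj₂ refl with step-other-end g-step′ (step-flip g-step) a′≢c′
  ...     | refl = j , fresh

  -- By strong induction on the length: the last edge g of the walk is the leaf
  -- edge itself, or it was removed earlier as a leaf edge at its other end y,
  -- so the walk up to y shortens to one reaching c, which shortens again.
  module _ {x} (x-core : CoreVertex G x) where

    ShortcutBelow : ℕ → Set
    ShortcutBelow n = ∀ {c} (W : Walk G x c) → length G W ≡ n → ∀ i {h a} → FreshLeaf i h a c →
                      Σ (Walk G x a) λ W′ → length G W′ ℕ.< n

    shortcut-step : ∀ n → (∀ {n′} → n′ ℕ.< n → ShortcutBelow n′) → ShortcutBelow n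
    shortcut-step _ _   nil           refl i fresh = ⊥-elim (core-not-leaf fresh x-core)
    shortcut-step _ rec (cons e st W) refl i {h} {a} fresh@(leaf _ (h-step , a≢c , _)) =
      shorten (lastStep e st W)
      where
      shorten : LastStep (cons e st W) → Σ (Walk G x a) λ W′ → length G W′ ℕ.< length G (cons e st W)
      shorten record { init = W₁ ; edge = g ; step = g-step ; init-shorter = W₁<W } with g ≟ h
      ... | yes refl with step-other-end h-step g-step a≢c
      ...   | refl = W₁ , W₁<W
      shorten record { init = W₁ ; edge = g ; step = g-step ; init-shorter = W₁<W } | no g≢h
        with earlier-leaf fresh g-step g≢h
      ... | j , g-fresh with rec W₁<W W₁ refl j g-fresh
      ...   | W₂ , W₂<W₁ with rec (ℕP.<-trans W₂<W₁ W₁<W) W₂ refl i fresh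
      ...     | W₃ , W₃<W₂ = W₃ , ℕP.<-trans W₃<W₂ (ℕP.<-trans W₂<W₁ W₁<W)

    shortcut : ∀ {c} (W : Walk G x c) i {h a} → FreshLeaf i h a c →
               Σ (Walk G x a) λ W′ → length G W′ ℕ.< length G W
    shortcut W = <-rec ShortcutBelow shortcut-step (length G W) W refl

  oriented-step : ∀ {e u v} → Oriented G e u v → Step G e u v
  oriented-step (_ , (_ , _ , _ , st) , _) = st

  -- An oriented edge (u,v) is never removed as the pendant edge of its tail u:
  -- otherwise a shortest walk from the core through e could be shortened.
  tail-not-leaf : ∀ {e u v} → Oriented G e u v → ∀ i {a} → ¬ FreshLeaf i e a u
  tail-not-leaf (_ , (x , x-core , W , _) , minimal) i {a} fresh@(leaf _ (e-step , _))
    with shortcut x-core W i fresh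
  ... | W′ , W′<W = ℕP.<⇒≱ W′<W (ℕP.≤-pred (minimal a _ (x , x-core , W′ , e-step)))

  -- the number of rounds (among the first m) that an edge survives
  module Rank (e : E G) = EntryTime (λ k → e ∈? removed k) (λ j≤k → removed-mono j≤k)

  rank : E G → ℕ
  rank e = Rank.entry e m

  rank≤m : ∀ e → rank e ℕ.≤ m
  rank≤m e = Rank.entry≤ e m

  -- The rank strictly drops from a removed oriented edge (u,v) to the edges
  -- oriented out of v: e is removed as the pendant edge of v, after all of them.
  rank-drops : ∀ {e u v} → Oriented G e u v → Peeled G e →
               ∃[ j ] (j ℕ.< rank e × ∀ f w → Oriented G f v w → rank f ℕ.≤ j)
  rank-drops {e} oriented peeled with removal-round m (peeled⇒removed peeled)
  ... | j , j<m , a , c , fresh@(leaf e∉ (e-step , _ , others)) with step-target e-step (oriented-step oriented)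
  ...   | inj₂ refl = ⊥-elim (tail-not-leaf oriented j fresh)
  ...   | inj₁ refl = j , Rank.entry>-fails e e∉ j<m , below
    where
    below : ∀ f w → Oriented G f c w → rank f ℕ.≤ j
    below f w f-oriented with f ≟ e
    ... | yes refl = ⊥-elim (tail-not-leaf f-oriented j fresh)
    ... | no  f≢e  = Rank.entry≤-holds f (others f (w , oriented-step f-oriented) f≢e) m

lemma7 : (G : Graph) → Connected G → AtLeastTwoCycles G →
    Σ (E G → ℚ) λ Δ →
      (∀ e → ¬ InCore G e → (0ℚ < Δ e) × (Δ e ≤ 1ℚ)) ×
      (∀ e u v → Oriented G e u v →
        ∀ (L : List (E G)) → Unique L →
          (∀ f → f ∈ L → ∃[ w ] Oriented G f v w) →
          (∀ f → ∃[ w ] Oriented G f v w → f ∈ L) →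
          sumℚ (map Δ L) < Δ e)
lemma7 G _ _ = Δ , bounds , decreasing
  where
  open Graph G using (m)
  open Peeling G

  weight : E G → ℕ
  weight e = suc m ^ rank e

  open Rescale (suc m ^ m) weight

  bounds : ∀ e → ¬ InCore G e → (0ℚ < Δ e) × (Δ e ≤ 1ℚ)
  bounds e _ = Δ-positive e (ℕP.m^n>0 (suc m) (rank e))
             , Δ-≤1 e (ℕP.m≤n⇒m≤1+n (ℕP.^-monoʳ-≤ (suc m) (rank≤m e)))

  decreasing : ∀ e u v → Oriented G e u v → ∀ (L : List (E G)) → Unique L →
               (∀ f → f ∈ L → ∃[ w ] Oriented G f v w) →
               (∀ f → ∃[ w ] Oriented G f v w → f ∈ L) →
               sumℚ (map Δ L) < Δ e
  decreasing e u v oriented L unique-L out-of-v _ =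
    decidable-stable (sumℚ (map Δ L) <? Δ e) λ ¬goal → proj₁ oriented λ peeled → ¬goal (from-peeled peeled)
    where
    -- e is not in the core, i.e. not unpeeled; since the goal is decidable
    -- this double negation may be removed and e assumed peeled
    from-peeled : Peeled G e → sumℚ (map Δ L) < Δ e
    from-peeled peeled with rank-drops oriented peeled
    ... | j , j<rank , below = sum-Δ-< e L (ℕP.<-≤-trans
            (sum-of-powers-< weight m j L (unique-length≤ L unique-L)
               (λ f f∈L → ℕP.^-monoʳ-≤ (suc m) (below f _ (proj₂ (out-of-v f f∈L)))))
            (ℕP.^-monoʳ-≤ (suc m) j<rank))
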